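{- Let $G$ be a matching covered graph. Then $\operatorname{pmw}(G)\le\max\{\operatorname{pmw}(H): H\text{ a brick or brace of }G\}$.
   Context: All graphs are finite and simple. $\mathcal{M}(G)$ is the set of perfect matchings of $G$; $G$ is matching covered if connected and every edge lies in a perfect matching. For nonempty $X\subseteq V(G)$, $\partial(X)$ is the set of edges with exactly one endpoint in $X$ (shores $X$ and $V(G)\setminus X$), and $\operatorname{mp}(\partial(X))=\max_{M\in\mathcal{M}(G)}|M\cap\partial(X)|$. A PM-decomposition of $G$ is a pair $(T,\delta)$ with $T$ a cubic tree (all non-leaf vertices of degree 3) and $\delta$ a bijection from the leaves of $T$ to $V(G)$; each edge of $T$ splits the leaves into two sets whose $\delta$-images $X_1,X_2$ partition $V(G)$ and induces the cut $\partial(X_1)$; the width of $(T,\delta)$ is the maximum matching porosity of these cuts and $\operatorname{pmw}(G)$ is the minimum width of a PM-decomposition of $G$. A cut $\partial(Z)$ is tight if $|M\cap\partial(Z)|=1$ for all $M\in\mathcal{M}(G)$, nontrivial if both shores have at least two vertices; the $Z$-contraction of $G$ is obtained by identifying $Z$ into a single vertex and deleting parallel edges. A brace (resp. brick) is a bipartite (resp. non-bipartite) matching covered graph with no nontrivial tight cut. The bricks and braces of $G$ are the graphs obtained by repeatedly replacing a graph having a nontrivial tight cut $\partial(Z)$ by its two contractions (of $Z$ and of its complement) until no nontrivial tight cut remains; this list is independent of the choices made. -}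

module Defs where

open import Data.Nat using (ℕ; zero; suc; _+_; _≤_)
open import Data.Fin using (Fin; zero; suc)
open import Data.Bool using (Bool; true; false; if_then_else_; not; _∧_)
open import Data.Product using (Σ; ∃; ∃-syntax; _×_; _,_)
open import Data.Sum using (_⊎_)
open import Data.List using (List; []; _∷_; _++_)
open import Relation.Nullary using (¬_)
open import Relation.Binary.PropositionalEquality using (_≡_; _≢_)
open import Function using (_∘_)

count : ∀ {n} → (Fin n → Bool) → ℕ
count {zero} f = 0
count {suc n} f = (if f zero then 1 else 0) + count (f ∘ suc)

record Graph : Set where
  field
    n      : ℕ
    adj    : Fin n → Fin n → Bool
    sym    : ∀ u v → adj u v ≡ adj v u
    irrefl : ∀ u → adj u u ≡ false
open Graph public

VSet : Graph → Set
VSet G = Fin (n G) → Bool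

complement : (G : Graph) → VSet G → VSet G
complement G X = not ∘ X

degree : (G : Graph) → Fin (n G) → ℕ
degree G v = count (adj G v)

data Reach (G : Graph) : Fin (n G) → Fin (n G) → Set where
  here : ∀ {u} → Reach G u u
  step : ∀ {u v w} → adj G u v ≡ true → Reach G v w → Reach G u w

data ReachAvoid (G : Graph) (a b : Fin (n G)) : Fin (n G) → Fin (n G) → Set where
  here : ∀ {u} → ReachAvoid G a b u u
  step : ∀ {u v w} → adj G u v ≡ true →
         ¬ (u ≡ a × v ≡ b) → ¬ (u ≡ b × v ≡ a) →
         ReachAvoid G a b v w → ReachAvoid G a b u w

Connected : Graph → Set
Connected G = ∀ u v → Reach G u v

record PerfectMatching (G : Graph) : Set where
  field
    mate     : Fin (n G) → Fin (n G)
    mate-adj : ∀ v → adj G v (mate v) ≡ true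
    mate-inv : ∀ v → mate (mate v) ≡ v
open PerfectMatching public

-- |M ∩ ∂(X)|: number of vertices of X whose partner lies outside X
-- (each edge of M ∩ ∂(X) has exactly one endpoint in X).
cutSize : {G : Graph} → PerfectMatching G → VSet G → ℕ
cutSize M X = count (λ v → X v ∧ not (X (mate M v)))

PorosityAtMost : (G : Graph) → VSet G → ℕ → Set
PorosityAtMost G X k = (M : PerfectMatching G) → cutSize M X ≤ k

MatchingCovered : Graph → Set
MatchingCovered G =
  Connected G ×
  (∀ u v → adj G u v ≡ true → Σ (PerfectMatching G) λ M → mate M u ≡ v)

-- A tree: connected and acyclic, acyclicity expressed as
-- "every edge is a bridge" (u,v not connected in T - uv).
IsTree : Graph → Set
IsTree T = Connected T × (∀ a b → adj T a b ≡ true → ¬ ReachAvoid T a b a b)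

IsLeaf : (T : Graph) → Fin (n T) → Set
IsLeaf T v = degree T v ≤ 1

IsCubicTree : Graph → Set
IsCubicTree T = IsTree T × (∀ v → IsLeaf T v ⊎ degree T v ≡ 3)

record PMDecomposition (G : Graph) : Set where
  field
    T        : Graph
    cubic    : IsCubicTree T
    -- ℓ = δ⁻¹ : V(G) → leaves(T), a bijection onto the leaves.
    ℓ        : Fin (n G) → Fin (n T)
    ℓ-inj    : ∀ x y → ℓ x ≡ ℓ y → x ≡ y
    ℓ-leaf   : ∀ x → IsLeaf T (ℓ x)
    ℓ-onto   : ∀ w → IsLeaf T w → ∃[ x ] ℓ x ≡ w
open PMDecomposition public

-- Width ≤ k: for every edge ab of T, let S be the component of T - ab
-- containing a; the induced cut ∂(X₁) with X₁ = δ(S ∩ leaves) has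
-- matching porosity at most k.
WidthAtMost : {G : Graph} → PMDecomposition G → ℕ → Set
WidthAtMost {G} D k =
  ∀ a b → adj (T D) a b ≡ true →
  (S : Fin (n (T D)) → Bool) →
  (∀ w → (S w ≡ true → ReachAvoid (T D) a b a w) ×
         (ReachAvoid (T D) a b a w → S w ≡ true)) →
  PorosityAtMost G (S ∘ ℓ D) k

PMWAtMost : Graph → ℕ → Set
PMWAtMost G k = Σ (PMDecomposition G) λ D → WidthAtMost D k

TightCut : (G : Graph) → VSet G → Set
TightCut G Z = (M : PerfectMatching G) → cutSize M Z ≡ 1

NontrivialTightCut : (G : Graph) → VSet G → Set
NontrivialTightCut G Z =
  TightCut G Z × 2 ≤ count Z × 2 ≤ count (complement G Z)

NoNontrivialTightCut : Graph → Set
NoNontrivialTightCut G = (Z : VSet G) → ¬ NontrivialTightCut G Z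

Bipartite : Graph → Set
Bipartite G = Σ (Fin (n G) → Bool) λ c → (∀ u v → adj G u v ≡ true → c u ≢ c v)

Brace : Graph → Set
Brace G = Bipartite G × MatchingCovered G × NoNontrivialTightCut G

Brick : Graph → Set
Brick G = ¬ Bipartite G × MatchingCovered G × NoNontrivialTightCut G

-- H is (isomorphic to) the Z-contraction G/Z: there is a surjection
-- φ : V(G) → V(H) that identifies exactly the vertices of Z (into one
-- vertex) and is injective elsewhere, and ab ∈ E(H) iff a ≠ b and some
-- edge uv of G has φ u = a, φ v = b (loops removed, parallel edges merged).
IsContraction : (G : Graph) → VSet G → Graph → Set
IsContraction G Z H =
  Σ (Fin (n G) → Fin (n H)) λ φ →
    (∀ a → ∃[ u ] φ u ≡ a) ×
    (∀ u v → Z u ≡ true → Z v ≡ true → φ u ≡ φ v) ×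
    (∀ u v → φ u ≡ φ v → u ≡ v ⊎ (Z u ≡ true × Z v ≡ true)) ×
    (∀ a b → (adj H a b ≡ true →
               a ≢ b × ∃[ u ] ∃[ v ] (φ u ≡ a × φ v ≡ b × adj G u v ≡ true)) ×
             (a ≢ b × ∃[ u ] ∃[ v ] (φ u ≡ a × φ v ≡ b × adj G u v ≡ true) →
               adj H a b ≡ true))

data TightCutDecomposition (G : Graph) : Set where
  done  : Brick G ⊎ Brace G → TightCutDecomposition G
  split : (Z : VSet G) → NontrivialTightCut G Z →
          (H₁ H₂ : Graph) →
          IsContraction G Z H₁ → IsContraction G (complement G Z) H₂ →
          TightCutDecomposition H₁ → TightCutDecomposition H₂ →
          TightCutDecomposition G

bricksAndBraces : {G : Graph} → TightCutDecomposition G → List Graph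
bricksAndBraces {G} (done _) = G ∷ []
bricksAndBraces (split _ _ _ _ _ _ D₁ D₂) = bricksAndBraces D₁ ++ bricksAndBraces D₂

module Submission where

-- Let ∂(Z) be a nontrivial tight cut of G, and take PM-decompositions (T₁, δ₁) of G/Z and
-- (T₂, δ₂) of G/Z̄ of width at most k. The contracted vertex of G/Z is a leaf t₁ of T₁ and
-- that of G/Z̄ a leaf t₂ of T₂; deleting t₁ and t₂ and joining their neighbours gives a
-- cubic tree whose leaves are exactly the vertices of G. Every edge of it comes from an
-- edge of T₁ (or T₂), and the cut of G it induces is the preimage under G → G/Z (or
-- G → G/Z̄) of the cut induced there. Since ∂(Z) is tight, a perfect matching of G
-- crosses it exactly once and so contracts to a perfect matching of G/Z meeting that cut
-- in equally many edges: the width stays at most k. Induction along the tight cut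
-- decomposition finishes the proof.

open import Defs hiding (sym)
open import Data.Bool using (Bool; true; false; if_then_else_; not; _∧_)
open import Data.Bool.Properties using (∧-comm; ∧-inverseʳ; ¬-not; not-injective)
open import Data.Empty using (⊥-elim)
open import Data.Fin using (Fin; zero; suc; punchIn; punchOut; splitAt; join; _↑ˡ_; _↑ʳ_)
open import Data.Fin.Properties
  using (_≟_; punchIn-injective; punchInᵢ≢i; punchIn-punchOut; splitAt-join; join-splitAt)
open import Data.List.Relation.Unary.All using (All; []; _∷_)
open import Data.List.Relation.Unary.All.Properties using (++⁻ˡ; ++⁻ʳ)
open import Data.Nat using (ℕ; zero; suc; _+_; _≤_; z≤n; s≤s; pred)
open import Data.Nat.Properties using (+-comm; +-assoc; ≤-trans; m≤n+m; +-0-commutativeMonoid)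
open import Algebra.Properties.CommutativeMonoid.Sum +-0-commutativeMonoid
  using (sum; sum-remove; ∑-comm; sum-cong-≗)
open import Data.Product using (∃-syntax; _×_; _,_; proj₁; proj₂)
open import Data.Sum using (_⊎_; inj₁; inj₂)
open import Data.Sum.Properties using (inj₁-injective; inj₂-injective)
open import Function using (_∘_)
open import Relation.Nullary using (¬_; yes; no; does)
open import Relation.Nullary.Decidable using (dec-true)
open import Relation.Binary.PropositionalEquality
  using (_≡_; _≢_; refl; sym; trans; cong; cong₂; subst; subst₂; module ≡-Reasoning)

ind : Bool → ℕ
ind b = if b then 1 else 0

true≢false : true ≢ false
true≢false ()

∧-true⇒ˡ : ∀ {b c} → b ∧ c ≡ true → b ≡ true
∧-true⇒ˡ {true} _ = refl

∧-true⇒ʳ : ∀ {b c} → b ∧ c ≡ true → c ≡ true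
∧-true⇒ʳ {true} e = e

_==_ : ∀ {n} → Fin n → Fin n → Bool
i == j = does (i ≟ j)

==-refl : ∀ {n} (i : Fin n) → (i == i) ≡ true
==-refl i = dec-true (i ≟ i) refl

==⇒≡ : ∀ {n} {i j : Fin n} → (i == j) ≡ true → i ≡ j
==⇒≡ {i = i} {j} e with i ≟ j
... | yes p = p

-- Counting

count-as-sum : ∀ {n} (f : Fin n → Bool) → count f ≡ sum (ind ∘ f)
count-as-sum {zero} f = refl
count-as-sum {suc n} f = cong (ind (f zero) +_) (count-as-sum (f ∘ suc))

count-cong : ∀ {n} {f g : Fin n → Bool} → (∀ v → f v ≡ g v) → count f ≡ count g
count-cong {zero} e = refl
count-cong {suc n} e = cong₂ (λ a b → ind a + b) (e zero) (count-cong (e ∘ suc))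

count-false : ∀ {n} (f : Fin n → Bool) → (∀ v → f v ≡ false) → count f ≡ 0
count-false {zero} f e = refl
count-false {suc n} f e rewrite e zero = count-false (f ∘ suc) (e ∘ suc)

count-punchIn : ∀ {n} (t : Fin (suc n)) (f : Fin (suc n) → Bool) →
  count f ≡ ind (f t) + count (f ∘ punchIn t)
count-punchIn t f = begin
  count f                          ≡⟨ count-as-sum f ⟩
  sum (ind ∘ f)                    ≡⟨ sum-remove {i = t} (ind ∘ f) ⟩
  ind (f t) + sum (ind ∘ f ∘ punchIn t) ≡⟨ cong (ind (f t) +_) (count-as-sum (f ∘ punchIn t)) ⟨
  ind (f t) + count (f ∘ punchIn t) ∎
  where open ≡-Reasoning

count-singleton : ∀ {n} (f : Fin n → Bool) (u : Fin n) →
  (∀ v → f v ≡ true → v ≡ u) → count f ≡ ind (f u)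
count-singleton {suc n} f u only-u = begin
  count f                               ≡⟨ count-punchIn u f ⟩
  ind (f u) + count (f ∘ punchIn u)     ≡⟨ cong (ind (f u) +_) (count-false _ off-u) ⟩
  ind (f u) + 0                         ≡⟨ +-comm (ind (f u)) 0 ⟩
  ind (f u)                             ∎
  where
  open ≡-Reasoning
  off-u : ∀ v → f (punchIn u v) ≡ false
  off-u v = ¬-not (λ fv → punchInᵢ≢i u v (only-u _ fv))

witness⇒count≥1 : ∀ {n} (f : Fin n → Bool) (v : Fin n) → f v ≡ true → 1 ≤ count f
witness⇒count≥1 {suc n} f zero e rewrite e = s≤s z≤n
witness⇒count≥1 {suc n} f (suc v) e = ≤-trans (witness⇒count≥1 (f ∘ suc) v e) (m≤n+m _ (ind (f zero)))

count≥1⇒witness : ∀ {n} (f : Fin n → Bool) → 1 ≤ count f → ∃[ v ] f v ≡ true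
count≥1⇒witness {suc n} f le with f zero in e
... | true = zero , e
... | false = let (v , p) = count≥1⇒witness (f ∘ suc) le in suc v , p

count≤1⇒unique : ∀ {n} (f : Fin n → Bool) → count f ≤ 1 →
  ∀ {u v} → f u ≡ true → f v ≡ true → u ≡ v
count≤1⇒unique {suc n} f le {u} {v} fu fv with u ≟ v
... | yes u≡v = u≡v
... | no u≢v = ⊥-elim (2≰1 (≤-trans 2≤count le))
  where
  2≰1 : ¬ (2 ≤ 1)
  2≰1 (s≤s ())
  2≤count : 2 ≤ count f
  2≤count rewrite count-punchIn u f | fu =
    s≤s (witness⇒count≥1 _ (punchOut u≢v) (trans (cong f (punchIn-punchOut u≢v)) fv))

count-==-∧ : ∀ {n} (p : Fin n) (c : Bool) → count (λ j → (j == p) ∧ c) ≡ ind c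
count-==-∧ p c =
  trans (count-singleton _ p (λ j e → ==⇒≡ (∧-true⇒ˡ e))) (cong (λ b → ind (b ∧ c)) (==-refl p))

count-∧-== : ∀ {n} (c : Bool) (p : Fin n) → count (λ j → c ∧ (j == p)) ≡ ind c
count-∧-== c p = trans (count-cong (λ j → ∧-comm c (j == p))) (count-==-∧ p c)

count-join : ∀ m n (f : Fin (m + n) → Bool) →
  count f ≡ count (f ∘ (_↑ˡ n)) + count (f ∘ (m ↑ʳ_))
count-join zero n f = refl
count-join (suc m) n f =
  trans (cong (ind (f zero) +_) (count-join m n (f ∘ suc))) (sym (+-assoc (ind (f zero)) _ _))

count-by-fibres : ∀ {n m} (φ : Fin n → Fin m) (g : Fin n → Bool) →
  count g ≡ sum (λ a → count (λ v → (φ v == a) ∧ g v))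
count-by-fibres {n} {m} φ g = begin
  count g                             ≡⟨ count-as-sum g ⟩
  sum (ind ∘ g)                       ≡⟨ sum-cong-≗ single ⟩
  sum (λ v → sum (λ a → ind (g∣ a v))) ≡⟨ ∑-comm (λ v a → ind (g∣ a v)) ⟩
  sum (λ a → sum (ind ∘ g∣ a))        ≡⟨ sum-cong-≗ (λ a → count-as-sum (g∣ a)) ⟨
  sum (λ a → count (g∣ a))            ∎
  where
  open ≡-Reasoning
  g∣ : Fin m → Fin n → Bool
  g∣ a v = (φ v == a) ∧ g v
  single : ∀ v → ind (g v) ≡ sum (λ a → ind (g∣ a v))
  single v = begin
    ind (g v)                   ≡⟨ cong (λ b → ind (b ∧ g v)) (==-refl (φ v)) ⟨
    ind (g∣ (φ v) v)
      ≡⟨ count-singleton (λ a → g∣ a v) (φ v) (λ a e → sym (==⇒≡ (∧-true⇒ˡ e))) ⟨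
    count (λ a → g∣ a v)        ≡⟨ count-as-sum (λ a → g∣ a v) ⟩
    sum (λ a → ind (g∣ a v))    ∎

count-bijection : ∀ {n m} (φ : Fin n → Fin m) (g : Fin n → Bool) (h : Fin m → Bool) →
  (∀ a → ∃[ u ] φ u ≡ a × g u ≡ h a × (∀ v → φ v ≡ a → g v ≡ true → v ≡ u)) →
  count g ≡ count h
count-bijection φ g h fibre = begin
  count g                                       ≡⟨ count-by-fibres φ g ⟩
  sum (λ a → count (λ v → (φ v == a) ∧ g v))    ≡⟨ sum-cong-≗ one ⟩
  sum (ind ∘ h)                                 ≡⟨ count-as-sum h ⟨
  count h                                       ∎
  where
  open ≡-Reasoning
  one : ∀ a → count (λ v → (φ v == a) ∧ g v) ≡ ind (h a)
  one a with fibre a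
  ... | u , φu≡a , gu≡ha , unique = begin
    count (λ v → (φ v == a) ∧ g v)
      ≡⟨ count-singleton _ u (λ v e → unique v (==⇒≡ (∧-true⇒ˡ e)) (∧-true⇒ʳ e)) ⟩
    ind ((φ u == a) ∧ g u)           ≡⟨ cong (λ x → ind ((x == a) ∧ g u)) φu≡a ⟩
    ind ((a == a) ∧ g u)             ≡⟨ cong₂ (λ b c → ind (b ∧ c)) (==-refl a) gu≡ha ⟩
    ind (h a)                        ∎

count-∘-involution : ∀ {n} (π : Fin n → Fin n) → (∀ v → π (π v) ≡ v) →
  (f : Fin n → Bool) → count (f ∘ π) ≡ count f
count-∘-involution π inv f =
  count-bijection π (f ∘ π) f (λ a → π a , inv a , cong f (inv a) , λ v e _ → trans (sym (inv v)) (cong π e))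

-- Cuts, tight cuts and contractions

cutSize-cong : ∀ {G} (M : PerfectMatching G) {X Y : VSet G} → (∀ v → X v ≡ Y v) →
  cutSize M X ≡ cutSize M Y
cutSize-cong M X≗Y = count-cong (λ v → cong₂ (λ a b → a ∧ not b) (X≗Y v) (X≗Y (mate M v)))

porosity-cong : ∀ {G k} {X Y : VSet G} → (∀ v → X v ≡ Y v) →
  PorosityAtMost G X k → PorosityAtMost G Y k
porosity-cong {k = k} X≗Y P M = subst (_≤ k) (cutSize-cong M X≗Y) (P M)

cutSize-complement : ∀ {G} (M : PerfectMatching G) (X : VSet G) →
  cutSize M (complement G X) ≡ cutSize M X
cutSize-complement M X =
  trans (count-cong swap) (count-∘-involution (mate M) (mate-inv M) (λ v → X v ∧ not (X (mate M v))))
  where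
  swap-∧ : ∀ a b → not a ∧ not (not b) ≡ b ∧ not a
  swap-∧ false false = refl
  swap-∧ false true = refl
  swap-∧ true false = refl
  swap-∧ true true = refl
  swap : ∀ v → not (X v) ∧ not (not (X (mate M v))) ≡ X (mate M v) ∧ not (X (mate M (mate M v)))
  swap v = trans (swap-∧ (X v) (X (mate M v))) (cong (λ u → X (mate M v) ∧ not (X u)) (sym (mate-inv M v)))

tight-complement : ∀ {G} {Z : VSet G} → TightCut G Z → TightCut G (complement G Z)
tight-complement {Z = Z} tight M = trans (cutSize-complement M Z) (tight M)

module Contraction {G H : Graph} {Z : VSet G} (C : IsContraction G Z H) where

  φ : Fin (n G) → Fin (n H)
  φ = proj₁ C

  φ-surjective : ∀ a → ∃[ u ] φ u ≡ a
  φ-surjective = proj₁ (proj₂ C)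

  φ-identifies-Z : ∀ u v → Z u ≡ true → Z v ≡ true → φ u ≡ φ v
  φ-identifies-Z = proj₁ (proj₂ (proj₂ C))

  φ-injective-off-Z : ∀ u v → φ u ≡ φ v → u ≡ v ⊎ (Z u ≡ true × Z v ≡ true)
  φ-injective-off-Z = proj₁ (proj₂ (proj₂ (proj₂ C)))

  φ-edge : ∀ {u v} → φ u ≢ φ v → adj G u v ≡ true → adj H (φ u) (φ v) ≡ true
  φ-edge {u} {v} φu≢φv uv =
    proj₂ (proj₂ (proj₂ (proj₂ (proj₂ C))) (φ u) (φ v)) (φu≢φv , u , v , refl , refl , uv)

  module Induced (tight : TightCut G Z) (M : PerfectMatching G) where

    crosses : Fin (n G) → Bool
    crosses v = Z v ∧ not (Z (mate M v))

    crossing : ∃[ w ] crosses w ≡ true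
    crossing = count≥1⇒witness crosses (subst (1 ≤_) (sym (tight M)) (s≤s z≤n))

    w : Fin (n G)
    w = proj₁ crossing

    w∈Z : Z w ≡ true
    w∈Z = ∧-true⇒ˡ (proj₂ crossing)

    mate-w∉Z : Z (mate M w) ≡ false
    mate-w∉Z = not-injective (∧-true⇒ʳ (proj₂ crossing))

    crossing-unique : ∀ v → Z v ≡ true → Z (mate M v) ≡ false → v ≡ w
    crossing-unique v v∈Z mate-v∉Z =
      count≤1⇒unique crosses (subst (_≤ 1) (sym (tight M)) (s≤s z≤n))
        (cong₂ (λ a b → a ∧ not b) v∈Z mate-v∉Z) (proj₂ crossing)

    -- rep a is the only vertex over a that lies outside Z or equals w.
    rep : Fin (n H) → Fin (n G)
    rep a = if Z pick then w else pick
      where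
      pick : Fin (n G)
      pick = proj₁ (φ-surjective a)

    rep-cases : ∀ a → ∃[ u ] φ u ≡ a × ((Z u ≡ true × rep a ≡ w) ⊎ (Z u ≡ false × rep a ≡ u))
    rep-cases a with φ-surjective a
    ... | u , φu≡a with Z u in u∈Z
    ...   | true = u , φu≡a , inj₁ (u∈Z , refl)
    ...   | false = u , φu≡a , inj₂ (u∈Z , refl)

    φ-rep : ∀ a → φ (rep a) ≡ a
    φ-rep a with rep-cases a
    ... | u , φu≡a , inj₁ (u∈Z , rep≡w) = trans (cong φ rep≡w) (trans (φ-identifies-Z w u w∈Z u∈Z) φu≡a)
    ... | u , φu≡a , inj₂ (_ , rep≡u) = trans (cong φ rep≡u) φu≡a

    rep∈Z⇒rep≡w : ∀ a → Z (rep a) ≡ true → rep a ≡ w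
    rep∈Z⇒rep≡w a rep∈Z with rep-cases a
    ... | _ , _ , inj₁ (_ , rep≡w) = rep≡w
    ... | u , _ , inj₂ (u∉Z , rep≡u) = ⊥-elim (true≢false (trans (sym rep∈Z) (trans (cong Z rep≡u) u∉Z)))

    fibre-rep : ∀ a v → φ v ≡ a → v ≡ rep a ⊎ (Z v ≡ true × rep a ≡ w)
    fibre-rep a v φv≡a with φ-injective-off-Z v (rep a) (trans φv≡a (sym (φ-rep a)))
    ... | inj₁ v≡rep = inj₁ v≡rep
    ... | inj₂ (v∈Z , rep∈Z) = inj₂ (v∈Z , rep∈Z⇒rep≡w a rep∈Z)

    rep∈Z⇒mate∉Z : ∀ a → Z (rep a) ≡ true → Z (mate M (rep a)) ≡ false
    rep∈Z⇒mate∉Z a rep∈Z = trans (cong (Z ∘ mate M) (rep∈Z⇒rep≡w a rep∈Z)) mate-w∉Z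

    rep-φ-mate : ∀ a → rep (φ (mate M (rep a))) ≡ mate M (rep a)
    rep-φ-mate a with fibre-rep (φ (mate M (rep a))) (mate M (rep a)) refl
    ... | inj₁ v≡rep = sym v≡rep
    ... | inj₂ (v∈Z , rep≡w) = trans rep≡w (sym (crossing-unique _ v∈Z mate-v∉Z))
      where
      mate-v∉Z : Z (mate M (mate M (rep a))) ≡ false
      mate-v∉Z = trans (cong Z (mate-inv M (rep a)))
        (¬-not (λ rep∈Z → true≢false (trans (sym v∈Z) (rep∈Z⇒mate∉Z a rep∈Z))))

    μ : Fin (n H) → Fin (n H)
    μ a = φ (mate M (rep a))

    μ-adj : ∀ a → adj H a (μ a) ≡ true
    μ-adj a = subst (λ x → adj H x (μ a) ≡ true) (φ-rep a) (φ-edge distinct (mate-adj M (rep a)))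
      where
      distinct : φ (rep a) ≢ μ a
      distinct e with φ-injective-off-Z (rep a) (mate M (rep a)) e
      ... | inj₁ loop = true≢false (trans (sym (mate-adj M (rep a)))
                          (trans (cong (adj G (rep a)) (sym loop)) (irrefl G (rep a))))
      ... | inj₂ (rep∈Z , mate∈Z) = true≢false (trans (sym mate∈Z) (rep∈Z⇒mate∉Z a rep∈Z))

    μ-inv : ∀ a → μ (μ a) ≡ a
    μ-inv a = begin
      φ (mate M (rep (φ (mate M (rep a)))))  ≡⟨ cong (φ ∘ mate M) (rep-φ-mate a) ⟩
      φ (mate M (mate M (rep a)))            ≡⟨ cong φ (mate-inv M (rep a)) ⟩
      φ (rep a)                              ≡⟨ φ-rep a ⟩
      a                                      ∎
      where open ≡-Reasoning

    induced : PerfectMatching H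
    induced = record { mate = μ ; mate-adj = μ-adj ; mate-inv = μ-inv }

    cutSize-induced : (X : VSet H) → cutSize M (X ∘ φ) ≡ cutSize induced X
    cutSize-induced X = count-bijection φ g h
      (λ a → rep a , φ-rep a , cong (λ x → X x ∧ not (X (μ a))) (φ-rep a) , unique a)
      where
      g : Fin (n G) → Bool
      g v = X (φ v) ∧ not (X (φ (mate M v)))
      h : Fin (n H) → Bool
      h a = X a ∧ not (X (μ a))
      unique : ∀ a v → φ v ≡ a → g v ≡ true → v ≡ rep a
      unique a v φv≡a gv with fibre-rep a v φv≡a
      ... | inj₁ v≡rep = v≡rep
      ... | inj₂ (v∈Z , rep≡w) with Z (mate M v) in mate-v∈Z
      ...   | false = trans (crossing-unique v v∈Z mate-v∈Z) (sym rep≡w)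
      ...   | true = ⊥-elim (true≢false (trans (sym gv) (trans same-side (∧-inverseʳ (X (φ v))))))
        where
        same-side : g v ≡ X (φ v) ∧ not (X (φ v))
        same-side = cong (λ x → X (φ v) ∧ not (X x)) (sym (φ-identifies-Z v (mate M v) v∈Z mate-v∈Z))

  porosity-pullback : TightCut G Z → ∀ X {k} → PorosityAtMost H X k → PorosityAtMost G (X ∘ φ) k
  porosity-pullback tight X {k} P M = subst (_≤ k) (sym (cutSize-induced X)) (P induced)
    where open Induced tight M

-- Walks and components

edge-sym : (G : Graph) → ∀ {u v} → adj G u v ≡ true → adj G v u ≡ true
edge-sym G {u} {v} uv = trans (Graph.sym G v u) uv

Reach-trans : ∀ {G : Graph} {x y z} → Reach G x y → Reach G y z → Reach G x z
Reach-trans here r = r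
Reach-trans (step e r) r′ = step e (Reach-trans r r′)

Reach-sym : ∀ {G : Graph} {x y} → Reach G x y → Reach G y x
Reach-sym here = here
Reach-sym {G} (step e r) = Reach-trans (Reach-sym r) (step (edge-sym G e) here)

Reach-map : ∀ {A B : Graph} (f : Fin (n A) → Fin (n B)) →
  (∀ u v → adj A u v ≡ true → adj B (f u) (f v) ≡ true) →
  ∀ {x y} → Reach A x y → Reach B (f x) (f y)
Reach-map f hom here = here
Reach-map f hom (step e r) = step (hom _ _ e) (Reach-map f hom r)

ReachAvoid-trans : ∀ {G : Graph} {a b x y z} →
  ReachAvoid G a b x y → ReachAvoid G a b y z → ReachAvoid G a b x z
ReachAvoid-trans here r = r
ReachAvoid-trans (step e ≢ab ≢ba r) r′ = step e ≢ab ≢ba (ReachAvoid-trans r r′)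

ReachAvoid-sym : ∀ {G : Graph} {a b x y} → ReachAvoid G a b x y → ReachAvoid G a b y x
ReachAvoid-sym here = here
ReachAvoid-sym {G} (step e ≢ab ≢ba r) =
  ReachAvoid-trans (ReachAvoid-sym r)
    (step (edge-sym G e) (λ (p , q) → ≢ba (q , p)) (λ (p , q) → ≢ab (q , p)) here)

IsComponent : (T : Graph) (a b : Fin (n T)) → (Fin (n T) → Bool) → Set
IsComponent T a b S = ∀ w → (S w ≡ true → ReachAvoid T a b a w) × (ReachAvoid T a b a w → S w ≡ true)

component-constant : ∀ {T : Graph} {a b S} → IsComponent T a b S →
  ∀ {x y} → ReachAvoid T a b x y → S x ≡ S y
component-constant {S = S} comp {x} {y} r with S x in Sx | S y in Sy
... | true | true = refl
... | false | false = refl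
... | true | false =
  ⊥-elim (true≢false (trans (sym (proj₂ (comp y) (ReachAvoid-trans (proj₁ (comp x) Sx) r))) Sy))
... | false | true =
  ⊥-elim (true≢false (trans (sym (proj₂ (comp x) (ReachAvoid-trans (proj₁ (comp y) Sy) (ReachAvoid-sym r)))) Sx))

leaf-neighbour-unique : (T : Graph) {t : Fin (n T)} → IsLeaf T t →
  ∀ {x y} → adj T t x ≡ true → adj T t y ≡ true → x ≡ y
leaf-neighbour-unique T {t} = count≤1⇒unique (adj T t)

has-neighbour : ∀ {T : Graph} {x y} → Reach T x y → x ≢ y → ∃[ q ] adj T x q ≡ true
has-neighbour here x≢y = ⊥-elim (x≢y refl)
has-neighbour (step {v = q} e _) _ = q , e

module Retraction {N T : Graph} (π : Fin (n N) → Fin (n T)) (σ : Fin (n T) → Fin (n N))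
  (π∘σ : ∀ u → π (σ u) ≡ u)
  (σ-edge : ∀ u v → adj T u v ≡ true → adj N (σ u) (σ v) ≡ true)
  (π-edge : ∀ u v → adj N u v ≡ true → π u ≡ π v ⊎ adj T (π u) (π v) ≡ true) where

  σ-injective : ∀ {x y} → σ x ≡ σ y → x ≡ y
  σ-injective {x} {y} e = trans (sym (π∘σ x)) (trans (cong π e) (π∘σ y))

  OnlyEdgeOver : Fin (n N) → Fin (n N) → Set
  OnlyEdgeOver a b = ∀ u v → adj N u v ≡ true → π u ≡ π a → π v ≡ π b → u ≡ a × v ≡ b

  ReachAvoid-π : ∀ {a b x y} → OnlyEdgeOver a b →
    ReachAvoid N a b x y → ReachAvoid T (π a) (π b) (π x) (π y)
  ReachAvoid-π only here = here
  ReachAvoid-π {a} {b} {y = y} only (step {u} {v} e ≢ab ≢ba r) with π-edge u v e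
  ... | inj₁ πu≡πv = subst (λ z → ReachAvoid T (π a) (π b) z (π y)) (sym πu≡πv) (ReachAvoid-π only r)
  ... | inj₂ πe = step πe (λ (p , q) → ≢ab (only u v e p q))
                    (λ (p , q) → let (v≡a , u≡b) = only v u (edge-sym N e) q p in ≢ba (u≡b , v≡a))
                    (ReachAvoid-π only r)

  ReachAvoid-σ : ∀ {c d x y} → ReachAvoid T c d x y → ReachAvoid N (σ c) (σ d) (σ x) (σ y)
  ReachAvoid-σ here = here
  ReachAvoid-σ (step e ≢cd ≢dc r) =
    step (σ-edge _ _ e) (λ (p , q) → ≢cd (σ-injective p , σ-injective q))
      (λ (p , q) → ≢dc (σ-injective p , σ-injective q)) (ReachAvoid-σ r)

  π-edge-separated : ∀ {a b} → adj N a b ≡ true → π a ≢ π b → adj T (π a) (π b) ≡ true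
  π-edge-separated {a} {b} e πa≢πb with π-edge a b e
  ... | inj₁ πa≡πb = ⊥-elim (πa≢πb πa≡πb)
  ... | inj₂ πe = πe

  LiftedEdge : Fin (n N) → Fin (n N) → Set
  LiftedEdge a b = OnlyEdgeOver a b × π a ≢ π b × σ (π a) ≡ a × σ (π b) ≡ b

  bridge-pullback : IsTree T → ∀ {a b} → adj N a b ≡ true → LiftedEdge a b → ¬ ReachAvoid N a b a b
  bridge-pullback tree e (only , πa≢πb , _) r =
    proj₂ tree _ _ (π-edge-separated e πa≢πb) (ReachAvoid-π only r)

  component-pullback : ∀ {a b S} → LiftedEdge a b →
    IsComponent N a b S → IsComponent T (π a) (π b) (S ∘ σ)
  component-pullback {a} {b} (only , _ , σπa , σπb) comp w =
    (λ S-σw → subst (ReachAvoid T (π a) (π b) (π a)) (π∘σ w) (ReachAvoid-π only (proj₁ (comp (σ w)) S-σw))) ,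
    (λ r → proj₂ (comp (σ w)) (subst₂ (λ p q → ReachAvoid N p q p (σ w)) σπa σπb (ReachAvoid-σ r)))

-- Joining two trees at leaves

-- Fin (pred N) stands for Fin N with one point removed; N need not be a successor.
punchIn′ : ∀ {N} → Fin N → Fin (pred N) → Fin N
punchIn′ {suc N} = punchIn

punchIn′-injective : ∀ {N} (t : Fin N) {i j} → punchIn′ t i ≡ punchIn′ t j → i ≡ j
punchIn′-injective {suc N} t = punchIn-injective t _ _

punchIn′≢ : ∀ {N} (t : Fin N) i → punchIn′ t i ≢ t
punchIn′≢ {suc N} = punchInᵢ≢i

punchOut′ : ∀ {N} {t u : Fin N} → t ≢ u → Fin (pred N)
punchOut′ {suc N} = punchOut

punchIn′-punchOut′ : ∀ {N} {t u : Fin N} (t≢u : t ≢ u) → punchIn′ t (punchOut′ t≢u) ≡ u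
punchIn′-punchOut′ {suc N} = punchIn-punchOut

punchIn′-view : ∀ {N} (t u : Fin N) → u ≡ t ⊎ ∃[ i ] u ≡ punchIn′ t i
punchIn′-view t u with u ≟ t
... | yes u≡t = inj₁ u≡t
... | no u≢t = inj₂ (punchOut′ (u≢t ∘ sym) , sym (punchIn′-punchOut′ (u≢t ∘ sym)))

count-punchIn′ : ∀ {N} (t : Fin N) (f : Fin N → Bool) → count f ≡ ind (f t) + count (f ∘ punchIn′ t)
count-punchIn′ {suc N} = count-punchIn

neighbour-punchOut′ : (T : Graph) → Connected T → ∀ {t u} → t ≢ u →
  ∃[ p ] adj T t (punchIn′ t p) ≡ true
neighbour-punchOut′ T conn {t} {u} t≢u with has-neighbour (conn t u) t≢u
... | q , tq = punchOut′ t≢q , trans (cong (adj T t) (punchIn′-punchOut′ t≢q)) tq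
  where
  t≢q : t ≢ q
  t≢q refl = true≢false (trans (sym tq) (irrefl T t))

-- Delete the leaves t₁ of T₁ and t₂ of T₂ and join their neighbours ι₁ p₁ and ι₂ p₂.
module TreeJoin {T₁ T₂ : Graph} {t₁ : Fin (n T₁)} {t₂ : Fin (n T₂)}
  (leaf₁ : IsLeaf T₁ t₁) (leaf₂ : IsLeaf T₂ t₂)
  (p₁ : Fin (pred (n T₁))) (p₂ : Fin (pred (n T₂)))
  (t₁p₁ : adj T₁ t₁ (punchIn′ t₁ p₁) ≡ true) (t₂p₂ : adj T₂ t₂ (punchIn′ t₂ p₂) ≡ true) where

  m₁ m₂ : ℕ
  m₁ = pred (n T₁)
  m₂ = pred (n T₂)

  ι₁ : Fin m₁ → Fin (n T₁)
  ι₁ = punchIn′ t₁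

  ι₂ : Fin m₂ → Fin (n T₂)
  ι₂ = punchIn′ t₂

  V : Set
  V = Fin m₁ ⊎ Fin m₂

  adjV : V → V → Bool
  adjV (inj₁ i) (inj₁ j) = adj T₁ (ι₁ i) (ι₁ j)
  adjV (inj₂ i) (inj₂ j) = adj T₂ (ι₂ i) (ι₂ j)
  adjV (inj₁ i) (inj₂ j) = (i == p₁) ∧ (j == p₂)
  adjV (inj₂ j) (inj₁ i) = (i == p₁) ∧ (j == p₂)

  adjV-sym : ∀ x y → adjV x y ≡ adjV y x
  adjV-sym (inj₁ i) (inj₁ j) = Graph.sym T₁ _ _
  adjV-sym (inj₂ i) (inj₂ j) = Graph.sym T₂ _ _
  adjV-sym (inj₁ i) (inj₂ j) = refl
  adjV-sym (inj₂ j) (inj₁ i) = refl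

  adjV-irrefl : ∀ x → adjV x x ≡ false
  adjV-irrefl (inj₁ i) = irrefl T₁ _
  adjV-irrefl (inj₂ i) = irrefl T₂ _

  toV : Fin (m₁ + m₂) → V
  toV = splitAt m₁

  fromV : V → Fin (m₁ + m₂)
  fromV = join m₁ m₂

  toV-fromV : ∀ s → toV (fromV s) ≡ s
  toV-fromV = splitAt-join m₁ m₂

  fromV-toV : ∀ x → fromV (toV x) ≡ x
  fromV-toV = join-splitAt m₁ m₂

  toV-injective : ∀ {x y} → toV x ≡ toV y → x ≡ y
  toV-injective {x} {y} e = trans (sym (fromV-toV x)) (trans (cong fromV e) (fromV-toV y))

  fromV-injective : ∀ {s s′} → fromV s ≡ fromV s′ → s ≡ s′
  fromV-injective {s} {s′} e = trans (sym (toV-fromV s)) (trans (cong toV e) (toV-fromV s′))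

  joined : Graph
  joined = record
    { n = m₁ + m₂ ; adj = λ x y → adjV (toV x) (toV y)
    ; sym = λ x y → adjV-sym (toV x) (toV y) ; irrefl = λ x → adjV-irrefl (toV x) }

  adj-fromV : ∀ x y → adj joined (fromV x) (fromV y) ≡ adjV x y
  adj-fromV x y = cong₂ adjV (toV-fromV x) (toV-fromV y)

  crossing-edge : ∀ {i j} → i ≡ p₁ → j ≡ p₂ → ((i == p₁) ∧ (j == p₂)) ≡ true
  crossing-edge refl refl = cong₂ _∧_ (==-refl p₁) (==-refl p₂)

  bridge : adj joined (fromV (inj₂ p₂)) (fromV (inj₁ p₁)) ≡ true
  bridge = trans (adj-fromV (inj₂ p₂) (inj₁ p₁)) (crossing-edge refl refl)

  neighbour₁ : ∀ {u} → adj T₁ t₁ u ≡ true → u ≡ ι₁ p₁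
  neighbour₁ e = leaf-neighbour-unique T₁ leaf₁ e t₁p₁

  neighbour₂ : ∀ {u} → adj T₂ t₂ u ≡ true → u ≡ ι₂ p₂
  neighbour₂ e = leaf-neighbour-unique T₂ leaf₂ e t₂p₂

  adj-ι₁-t₁ : ∀ i → adj T₁ (ι₁ i) t₁ ≡ (i == p₁)
  adj-ι₁-t₁ i with i ≟ p₁
  ... | yes refl = edge-sym T₁ t₁p₁
  ... | no i≢p₁ = ¬-not (λ e → i≢p₁ (punchIn′-injective t₁ (neighbour₁ (edge-sym T₁ e))))

  adj-ι₂-t₂ : ∀ j → adj T₂ (ι₂ j) t₂ ≡ (j == p₂)
  adj-ι₂-t₂ j with j ≟ p₂
  ... | yes refl = edge-sym T₂ t₂p₂
  ... | no j≢p₂ = ¬-not (λ e → j≢p₂ (punchIn′-injective t₂ (neighbour₂ (edge-sym T₂ e))))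

  degree-fromV : ∀ x → degree joined (fromV x) ≡ count (λ i → adjV x (inj₁ i)) + count (λ j → adjV x (inj₂ j))
  degree-fromV x = trans (count-join m₁ m₂ (adj joined (fromV x)))
    (cong₂ _+_ (count-cong (λ i → cong₂ adjV (toV-fromV x) (toV-fromV (inj₁ i))))
               (count-cong (λ j → cong₂ adjV (toV-fromV x) (toV-fromV (inj₂ j)))))

  degree-inj₁ : ∀ i → degree joined (fromV (inj₁ i)) ≡ degree T₁ (ι₁ i)
  degree-inj₁ i = begin
    degree joined (fromV (inj₁ i))                     ≡⟨ degree-fromV (inj₁ i) ⟩
    count (adj T₁ (ι₁ i) ∘ ι₁) + count (λ j → (i == p₁) ∧ (j == p₂))
      ≡⟨ cong (count (adj T₁ (ι₁ i) ∘ ι₁) +_) (count-∧-== (i == p₁) p₂) ⟩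
    count (adj T₁ (ι₁ i) ∘ ι₁) + ind (i == p₁)         ≡⟨ +-comm _ (ind (i == p₁)) ⟩
    ind (i == p₁) + count (adj T₁ (ι₁ i) ∘ ι₁)
      ≡⟨ cong (λ b → ind b + count (adj T₁ (ι₁ i) ∘ ι₁)) (adj-ι₁-t₁ i) ⟨
    ind (adj T₁ (ι₁ i) t₁) + count (adj T₁ (ι₁ i) ∘ ι₁) ≡⟨ count-punchIn′ t₁ (adj T₁ (ι₁ i)) ⟨
    degree T₁ (ι₁ i)                                   ∎
    where open ≡-Reasoning

  degree-inj₂ : ∀ j → degree joined (fromV (inj₂ j)) ≡ degree T₂ (ι₂ j)
  degree-inj₂ j = begin
    degree joined (fromV (inj₂ j))                     ≡⟨ degree-fromV (inj₂ j) ⟩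
    count (λ i → (i == p₁) ∧ (j == p₂)) + count (adj T₂ (ι₂ j) ∘ ι₂)
      ≡⟨ cong (_+ count (adj T₂ (ι₂ j) ∘ ι₂)) (count-==-∧ p₁ (j == p₂)) ⟩
    ind (j == p₂) + count (adj T₂ (ι₂ j) ∘ ι₂)
      ≡⟨ cong (λ b → ind b + count (adj T₂ (ι₂ j) ∘ ι₂)) (adj-ι₂-t₂ j) ⟨
    ind (adj T₂ (ι₂ j) t₂) + count (adj T₂ (ι₂ j) ∘ ι₂) ≡⟨ count-punchIn′ t₂ (adj T₂ (ι₂ j)) ⟨
    degree T₂ (ι₂ j)                                   ∎
    where open ≡-Reasoning

  -- t₁ stands for the far end ι₂ p₂ of the bridge: σ₁ sends it there, and π₁
  -- collapses the whole T₂ side onto t₁.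
  σ₁ : Fin (n T₁) → Fin (n joined)
  σ₁ u with punchIn′-view t₁ u
  ... | inj₁ _ = fromV (inj₂ p₂)
  ... | inj₂ (i , _) = fromV (inj₁ i)

  σ₂ : Fin (n T₂) → Fin (n joined)
  σ₂ u with punchIn′-view t₂ u
  ... | inj₁ _ = fromV (inj₁ p₁)
  ... | inj₂ (j , _) = fromV (inj₂ j)

  π₁ᵥ : V → Fin (n T₁)
  π₁ᵥ (inj₁ i) = ι₁ i
  π₁ᵥ (inj₂ _) = t₁

  π₂ᵥ : V → Fin (n T₂)
  π₂ᵥ (inj₁ _) = t₂
  π₂ᵥ (inj₂ j) = ι₂ j

  π₁ : Fin (n joined) → Fin (n T₁)
  π₁ = π₁ᵥ ∘ toV

  π₂ : Fin (n joined) → Fin (n T₂)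
  π₂ = π₂ᵥ ∘ toV

  σ₁-ι₁ : ∀ i → σ₁ (ι₁ i) ≡ fromV (inj₁ i)
  σ₁-ι₁ i with punchIn′-view t₁ (ι₁ i)
  ... | inj₁ ι₁i≡t₁ = ⊥-elim (punchIn′≢ t₁ i ι₁i≡t₁)
  ... | inj₂ (j , ι₁i≡ι₁j) = cong (fromV ∘ inj₁) (sym (punchIn′-injective t₁ ι₁i≡ι₁j))

  σ₁-t₁ : σ₁ t₁ ≡ fromV (inj₂ p₂)
  σ₁-t₁ with punchIn′-view t₁ t₁
  ... | inj₁ _ = refl
  ... | inj₂ (j , t₁≡ι₁j) = ⊥-elim (punchIn′≢ t₁ j (sym t₁≡ι₁j))

  σ₂-ι₂ : ∀ j → σ₂ (ι₂ j) ≡ fromV (inj₂ j)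
  σ₂-ι₂ j with punchIn′-view t₂ (ι₂ j)
  ... | inj₁ ι₂j≡t₂ = ⊥-elim (punchIn′≢ t₂ j ι₂j≡t₂)
  ... | inj₂ (i , ι₂j≡ι₂i) = cong (fromV ∘ inj₂) (sym (punchIn′-injective t₂ ι₂j≡ι₂i))

  σ₂-t₂ : σ₂ t₂ ≡ fromV (inj₁ p₁)
  σ₂-t₂ with punchIn′-view t₂ t₂
  ... | inj₁ _ = refl
  ... | inj₂ (i , t₂≡ι₂i) = ⊥-elim (punchIn′≢ t₂ i (sym t₂≡ι₂i))

  π₁-σ₁ : ∀ u → π₁ (σ₁ u) ≡ u
  π₁-σ₁ u with punchIn′-view t₁ u
  ... | inj₁ u≡t₁ = trans (cong π₁ᵥ (toV-fromV (inj₂ p₂))) (sym u≡t₁)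
  ... | inj₂ (i , u≡ι₁i) = trans (cong π₁ᵥ (toV-fromV (inj₁ i))) (sym u≡ι₁i)

  π₂-σ₂ : ∀ u → π₂ (σ₂ u) ≡ u
  π₂-σ₂ u with punchIn′-view t₂ u
  ... | inj₁ u≡t₂ = trans (cong π₂ᵥ (toV-fromV (inj₁ p₁))) (sym u≡t₂)
  ... | inj₂ (j , u≡ι₂j) = trans (cong π₂ᵥ (toV-fromV (inj₂ j))) (sym u≡ι₂j)

  σ₁-edge : ∀ u v → adj T₁ u v ≡ true → adj joined (σ₁ u) (σ₁ v) ≡ true
  σ₁-edge u v e with punchIn′-view t₁ u | punchIn′-view t₁ v
  ... | inj₁ refl | inj₁ refl = ⊥-elim (true≢false (trans (sym e) (irrefl T₁ t₁)))
  ... | inj₁ refl | inj₂ (j , refl) = trans (adj-fromV (inj₂ p₂) (inj₁ j))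
    (crossing-edge (punchIn′-injective t₁ (neighbour₁ e)) refl)
  ... | inj₂ (i , refl) | inj₁ refl = trans (adj-fromV (inj₁ i) (inj₂ p₂))
    (crossing-edge (punchIn′-injective t₁ (neighbour₁ (edge-sym T₁ e))) refl)
  ... | inj₂ (i , refl) | inj₂ (j , refl) = trans (adj-fromV (inj₁ i) (inj₁ j)) e

  σ₂-edge : ∀ u v → adj T₂ u v ≡ true → adj joined (σ₂ u) (σ₂ v) ≡ true
  σ₂-edge u v e with punchIn′-view t₂ u | punchIn′-view t₂ v
  ... | inj₁ refl | inj₁ refl = ⊥-elim (true≢false (trans (sym e) (irrefl T₂ t₂)))
  ... | inj₁ refl | inj₂ (j , refl) = trans (adj-fromV (inj₁ p₁) (inj₂ j))
    (crossing-edge refl (punchIn′-injective t₂ (neighbour₂ e)))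
  ... | inj₂ (i , refl) | inj₁ refl = trans (adj-fromV (inj₂ i) (inj₁ p₁))
    (crossing-edge refl (punchIn′-injective t₂ (neighbour₂ (edge-sym T₂ e))))
  ... | inj₂ (i , refl) | inj₂ (j , refl) = trans (adj-fromV (inj₂ i) (inj₂ j)) e

  π₁ᵥ-edge : ∀ s s′ → adjV s s′ ≡ true →
    π₁ᵥ s ≡ π₁ᵥ s′ ⊎ adj T₁ (π₁ᵥ s) (π₁ᵥ s′) ≡ true
  π₁ᵥ-edge (inj₁ i) (inj₁ j) e = inj₂ e
  π₁ᵥ-edge (inj₂ i) (inj₂ j) e = inj₁ refl
  π₁ᵥ-edge (inj₁ i) (inj₂ j) e = inj₂ (trans (adj-ι₁-t₁ i) (∧-true⇒ˡ e))
  π₁ᵥ-edge (inj₂ j) (inj₁ i) e =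
    inj₂ (trans (Graph.sym T₁ t₁ (ι₁ i)) (trans (adj-ι₁-t₁ i) (∧-true⇒ˡ e)))

  π₂ᵥ-edge : ∀ s s′ → adjV s s′ ≡ true →
    π₂ᵥ s ≡ π₂ᵥ s′ ⊎ adj T₂ (π₂ᵥ s) (π₂ᵥ s′) ≡ true
  π₂ᵥ-edge (inj₁ i) (inj₁ j) e = inj₁ refl
  π₂ᵥ-edge (inj₂ i) (inj₂ j) e = inj₂ e
  π₂ᵥ-edge (inj₁ i) (inj₂ j) e =
    inj₂ (trans (Graph.sym T₂ t₂ (ι₂ j)) (trans (adj-ι₂-t₂ j) (∧-true⇒ʳ e)))
  π₂ᵥ-edge (inj₂ j) (inj₁ i) e = inj₂ (trans (adj-ι₂-t₂ j) (∧-true⇒ʳ e))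

  module R₁ = Retraction {N = joined} {T = T₁} π₁ σ₁ π₁-σ₁ σ₁-edge
                (λ x y → π₁ᵥ-edge (toV x) (toV y))
  module R₂ = Retraction {N = joined} {T = T₂} π₂ σ₂ π₂-σ₂ σ₂-edge
                (λ x y → π₂ᵥ-edge (toV x) (toV y))

  only-edge-over₁ : ∀ i sb su sv → adjV (inj₁ i) sb ≡ true → adjV su sv ≡ true →
    π₁ᵥ su ≡ ι₁ i → π₁ᵥ sv ≡ π₁ᵥ sb → su ≡ inj₁ i × sv ≡ sb
  only-edge-over₁ i sb (inj₂ _) sv _ _ πu _ = ⊥-elim (punchIn′≢ t₁ i (sym πu))
  only-edge-over₁ i (inj₁ j) (inj₁ i′) (inj₁ j′) _ _ πu πv =
    cong inj₁ (punchIn′-injective t₁ πu) , cong inj₁ (punchIn′-injective t₁ πv)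
  only-edge-over₁ i (inj₁ j) (inj₁ i′) (inj₂ j′) _ _ _ πv = ⊥-elim (punchIn′≢ t₁ j (sym πv))
  only-edge-over₁ i (inj₂ j) (inj₁ i′) (inj₁ j′) _ _ _ πv = ⊥-elim (punchIn′≢ t₁ j′ πv)
  only-edge-over₁ i (inj₂ j) (inj₁ i′) (inj₂ j′) eb e πu _ =
    cong inj₁ (punchIn′-injective t₁ πu) ,
    cong inj₂ (trans (==⇒≡ (∧-true⇒ʳ e)) (sym (==⇒≡ (∧-true⇒ʳ eb))))

  only-edge-over₂ : ∀ j sb su sv → adjV (inj₂ j) sb ≡ true → adjV su sv ≡ true →
    π₂ᵥ su ≡ ι₂ j → π₂ᵥ sv ≡ π₂ᵥ sb → su ≡ inj₂ j × sv ≡ sb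
  only-edge-over₂ j sb (inj₁ _) sv _ _ πu _ = ⊥-elim (punchIn′≢ t₂ j (sym πu))
  only-edge-over₂ j (inj₂ i) (inj₂ j′) (inj₂ i′) _ _ πu πv =
    cong inj₂ (punchIn′-injective t₂ πu) , cong inj₂ (punchIn′-injective t₂ πv)
  only-edge-over₂ j (inj₂ i) (inj₂ j′) (inj₁ i′) _ _ _ πv = ⊥-elim (punchIn′≢ t₂ i (sym πv))
  only-edge-over₂ j (inj₁ i) (inj₂ j′) (inj₂ i′) _ _ _ πv = ⊥-elim (punchIn′≢ t₂ i′ πv)
  only-edge-over₂ j (inj₁ i) (inj₂ j′) (inj₁ i′) eb e πu _ =
    cong inj₂ (punchIn′-injective t₂ πu) ,
    cong inj₁ (trans (==⇒≡ (∧-true⇒ˡ e)) (sym (==⇒≡ (∧-true⇒ˡ eb))))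

  π₁ᵥ-separates : ∀ i sb → adjV (inj₁ i) sb ≡ true → ι₁ i ≢ π₁ᵥ sb
  π₁ᵥ-separates i (inj₁ j) e p with punchIn′-injective t₁ p
  ... | refl = true≢false (trans (sym e) (irrefl T₁ (ι₁ i)))
  π₁ᵥ-separates i (inj₂ j) e p = punchIn′≢ t₁ i p

  π₂ᵥ-separates : ∀ j sb → adjV (inj₂ j) sb ≡ true → ι₂ j ≢ π₂ᵥ sb
  π₂ᵥ-separates j (inj₂ i) e p with punchIn′-injective t₂ p
  ... | refl = true≢false (trans (sym e) (irrefl T₂ (ι₂ j)))
  π₂ᵥ-separates j (inj₁ i) e p = punchIn′≢ t₂ j p

  σ₁-π₁ᵥ : ∀ i sb → adjV (inj₁ i) sb ≡ true → σ₁ (π₁ᵥ sb) ≡ fromV sb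
  σ₁-π₁ᵥ i (inj₁ j) e = σ₁-ι₁ j
  σ₁-π₁ᵥ i (inj₂ j) e = trans σ₁-t₁ (cong (fromV ∘ inj₂) (sym (==⇒≡ (∧-true⇒ʳ e))))

  σ₂-π₂ᵥ : ∀ j sb → adjV (inj₂ j) sb ≡ true → σ₂ (π₂ᵥ sb) ≡ fromV sb
  σ₂-π₂ᵥ j (inj₂ i) e = σ₂-ι₂ i
  σ₂-π₂ᵥ j (inj₁ i) e = trans σ₂-t₂ (cong (fromV ∘ inj₁) (sym (==⇒≡ (∧-true⇒ˡ e))))

  lifted₁ : ∀ {a b i} → toV a ≡ inj₁ i → adj joined a b ≡ true → R₁.LiftedEdge a b
  lifted₁ {a} {b} {i} a≡i e = only , separated , σπa , σπb
    where
    e′ : adjV (inj₁ i) (toV b) ≡ true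
    e′ = subst (λ s → adjV s (toV b) ≡ true) a≡i e
    only : R₁.OnlyEdgeOver a b
    only u v uv πu πv with only-edge-over₁ i (toV b) (toV u) (toV v) e′ uv (trans πu (cong π₁ᵥ a≡i)) πv
    ... | u≡a , v≡b = toV-injective (trans u≡a (sym a≡i)) , toV-injective v≡b
    separated : π₁ a ≢ π₁ b
    separated p = π₁ᵥ-separates i (toV b) e′ (trans (sym (cong π₁ᵥ a≡i)) p)
    σπa : σ₁ (π₁ a) ≡ a
    σπa = trans (cong (σ₁ ∘ π₁ᵥ) a≡i) (trans (σ₁-ι₁ i) (trans (cong fromV (sym a≡i)) (fromV-toV a)))
    σπb : σ₁ (π₁ b) ≡ b
    σπb = trans (σ₁-π₁ᵥ i (toV b) e′) (fromV-toV b)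

  lifted₂ : ∀ {a b j} → toV a ≡ inj₂ j → adj joined a b ≡ true → R₂.LiftedEdge a b
  lifted₂ {a} {b} {j} a≡j e = only , separated , σπa , σπb
    where
    e′ : adjV (inj₂ j) (toV b) ≡ true
    e′ = subst (λ s → adjV s (toV b) ≡ true) a≡j e
    only : R₂.OnlyEdgeOver a b
    only u v uv πu πv with only-edge-over₂ j (toV b) (toV u) (toV v) e′ uv (trans πu (cong π₂ᵥ a≡j)) πv
    ... | u≡a , v≡b = toV-injective (trans u≡a (sym a≡j)) , toV-injective v≡b
    separated : π₂ a ≢ π₂ b
    separated p = π₂ᵥ-separates j (toV b) e′ (trans (sym (cong π₂ᵥ a≡j)) p)
    σπa : σ₂ (π₂ a) ≡ a
    σπa = trans (cong (σ₂ ∘ π₂ᵥ) a≡j) (trans (σ₂-ι₂ j) (trans (cong fromV (sym a≡j)) (fromV-toV a)))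
    σπb : σ₂ (π₂ b) ≡ b
    σπb = trans (σ₂-π₂ᵥ j (toV b) e′) (fromV-toV b)

  reach-p₁ : Connected T₁ → Connected T₂ → ∀ s → Reach joined (fromV s) (fromV (inj₁ p₁))
  reach-p₁ conn₁ conn₂ (inj₁ i) =
    Reach-trans (subst₂ (Reach joined) (σ₁-ι₁ i) σ₁-t₁ (Reach-map σ₁ σ₁-edge (conn₁ (ι₁ i) t₁)))
      (step bridge here)
  reach-p₁ conn₁ conn₂ (inj₂ j) =
    subst₂ (Reach joined) (σ₂-ι₂ j) σ₂-t₂ (Reach-map σ₂ σ₂-edge (conn₂ (ι₂ j) t₂))

  joined-connected : Connected T₁ → Connected T₂ → Connected joined
  joined-connected conn₁ conn₂ x y = subst₂ (Reach joined) (fromV-toV x) (fromV-toV y)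
    (Reach-trans (reach-p₁ conn₁ conn₂ (toV x)) (Reach-sym (reach-p₁ conn₁ conn₂ (toV y))))

  σ₁-avoids-side₂ : ∀ {x j u} → toV x ≡ inj₂ j → u ≢ t₁ → σ₁ u ≢ x
  σ₁-avoids-side₂ {x} {j} {u} x≡j u≢t₁ σu≡x with punchIn′-view t₁ u
  ... | inj₁ u≡t₁ = u≢t₁ u≡t₁
  ... | inj₂ (i , _) with trans (sym (toV-fromV (inj₁ i))) (trans (cong toV σu≡x) x≡j)
  ...   | ()

  σ₂-avoids-side₁ : ∀ {x i u} → toV x ≡ inj₁ i → u ≢ t₂ → σ₂ u ≢ x
  σ₂-avoids-side₁ {x} {i} {u} x≡i u≢t₂ σu≡x with punchIn′-view t₂ u
  ... | inj₁ u≡t₂ = u≢t₂ u≡t₂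
  ... | inj₂ (j , _) with trans (sym (toV-fromV (inj₂ j))) (trans (cong toV σu≡x) x≡i)
  ...   | ()

  -- A walk of T₂ towards ι₂ p₂ that stays off t₂ never meets an edge at a vertex of the T₁ side.
  reach-bridge₂ : ∀ {a b i} → toV a ≡ inj₁ i → ∀ {u} → Reach T₂ u (ι₂ p₂) → u ≢ t₂ →
    ReachAvoid joined a b (σ₂ u) (fromV (inj₂ p₂))
  reach-bridge₂ {a} {b} a≡i = walk
    where
    end : ∀ {u} → u ≡ ι₂ p₂ → ReachAvoid joined a b (σ₂ u) (fromV (inj₂ p₂))
    end refl = subst (λ z → ReachAvoid joined a b z (fromV (inj₂ p₂))) (sym (σ₂-ι₂ p₂)) here
    walk : ∀ {u} → Reach T₂ u (ι₂ p₂) → u ≢ t₂ → ReachAvoid joined a b (σ₂ u) (fromV (inj₂ p₂))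
    walk here _ = end refl
    walk {u} (step {v = x} e r) u≢t₂ with x ≟ t₂
    ... | yes refl = end (neighbour₂ (edge-sym T₂ e))
    ... | no x≢t₂ = step (σ₂-edge u x e) (λ (p , _) → σ₂-avoids-side₁ a≡i u≢t₂ p)
                      (λ (_ , q) → σ₂-avoids-side₁ a≡i x≢t₂ q) (walk r x≢t₂)

  reach-bridge₁ : ∀ {a b j} → toV a ≡ inj₂ j → ∀ {u} → Reach T₁ u (ι₁ p₁) → u ≢ t₁ →
    ReachAvoid joined a b (σ₁ u) (fromV (inj₁ p₁))
  reach-bridge₁ {a} {b} a≡j = walk
    where
    end : ∀ {u} → u ≡ ι₁ p₁ → ReachAvoid joined a b (σ₁ u) (fromV (inj₁ p₁))
    end refl = subst (λ z → ReachAvoid joined a b z (fromV (inj₁ p₁))) (sym (σ₁-ι₁ p₁)) here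
    walk : ∀ {u} → Reach T₁ u (ι₁ p₁) → u ≢ t₁ → ReachAvoid joined a b (σ₁ u) (fromV (inj₁ p₁))
    walk here _ = end refl
    walk {u} (step {v = x} e r) u≢t₁ with x ≟ t₁
    ... | yes refl = end (neighbour₁ (edge-sym T₁ e))
    ... | no x≢t₁ = step (σ₁-edge u x e) (λ (p , _) → σ₁-avoids-side₂ a≡j u≢t₁ p)
                      (λ (_ , q) → σ₁-avoids-side₂ a≡j x≢t₁ q) (walk r x≢t₁)

  joined-cubicTree : IsCubicTree T₁ → IsCubicTree T₂ → IsCubicTree joined
  joined-cubicTree (tree₁ , cubic₁) (tree₂ , cubic₂) =
    (joined-connected (proj₁ tree₁) (proj₁ tree₂) , acyclic) ,
    λ x → subst (λ z → IsLeaf joined z ⊎ degree joined z ≡ 3) (fromV-toV x) (cubicᵥ (toV x))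
    where
    acyclic : ∀ a b → adj joined a b ≡ true → ¬ ReachAvoid joined a b a b
    acyclic a b e = by-side (toV a) refl
      where
      by-side : ∀ s → toV a ≡ s → ¬ ReachAvoid joined a b a b
      by-side (inj₁ i) a≡i = R₁.bridge-pullback tree₁ e (lifted₁ a≡i e)
      by-side (inj₂ j) a≡j = R₂.bridge-pullback tree₂ e (lifted₂ a≡j e)
    cubicᵥ : ∀ s → IsLeaf joined (fromV s) ⊎ degree joined (fromV s) ≡ 3
    cubicᵥ (inj₁ i) with cubic₁ (ι₁ i)
    ... | inj₁ leaf = inj₁ (subst (_≤ 1) (sym (degree-inj₁ i)) leaf)
    ... | inj₂ deg3 = inj₂ (trans (degree-inj₁ i) deg3)
    cubicᵥ (inj₂ j) with cubic₂ (ι₂ j)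
    ... | inj₁ leaf = inj₁ (subst (_≤ 1) (sym (degree-inj₂ j)) leaf)
    ... | inj₂ deg3 = inj₂ (trans (degree-inj₂ j) deg3)

-- Gluing decompositions across a tight cut

module TightCutStep {G H₁ H₂ : Graph} {Z : VSet G} (tight : TightCut G Z)
  {z z̄ : Fin (n G)} (z∈Z : Z z ≡ true) (z̄∉Z : Z z̄ ≡ false)
  (C₁ : IsContraction G Z H₁) (C₂ : IsContraction G (complement G Z) H₂)
  (D₁ : PMDecomposition H₁) (D₂ : PMDecomposition H₂) where

  module C₁ = Contraction {G} {H₁} {Z} C₁
  module C₂ = Contraction {G} {H₂} {complement G Z} C₂

  λ₁ : Fin (n G) → Fin (n (T D₁))
  λ₁ = ℓ D₁ ∘ C₁.φ

  λ₂ : Fin (n G) → Fin (n (T D₂))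
  λ₂ = ℓ D₂ ∘ C₂.φ

  λ₁-injective-off-Z : ∀ {u v} → λ₁ u ≡ λ₁ v → u ≡ v ⊎ (Z u ≡ true × Z v ≡ true)
  λ₁-injective-off-Z e = C₁.φ-injective-off-Z _ _ (ℓ-inj D₁ _ _ e)

  λ₂-injective-off-Z̄ : ∀ {u v} → λ₂ u ≡ λ₂ v → u ≡ v ⊎ (Z u ≡ false × Z v ≡ false)
  λ₂-injective-off-Z̄ e with C₂.φ-injective-off-Z _ _ (ℓ-inj D₂ _ _ e)
  ... | inj₁ u≡v = inj₁ u≡v
  ... | inj₂ (u∉Z , v∉Z) = inj₂ (not-injective u∉Z , not-injective v∉Z)

  t₁ : Fin (n (T D₁))
  t₁ = λ₁ z

  t₂ : Fin (n (T D₂))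
  t₂ = λ₂ z̄

  t₁≢λ₁ : ∀ u → Z u ≡ false → t₁ ≢ λ₁ u
  t₁≢λ₁ u u∉Z e with λ₁-injective-off-Z e
  ... | inj₁ refl = true≢false (trans (sym z∈Z) u∉Z)
  ... | inj₂ (_ , u∈Z) = true≢false (trans (sym u∈Z) u∉Z)

  t₂≢λ₂ : ∀ u → Z u ≡ true → t₂ ≢ λ₂ u
  t₂≢λ₂ u u∈Z e with λ₂-injective-off-Z̄ e
  ... | inj₁ refl = true≢false (trans (sym u∈Z) z̄∉Z)
  ... | inj₂ (_ , u∉Z) = true≢false (trans (sym u∈Z) u∉Z)

  λ₁-Z : ∀ u → Z u ≡ true → λ₁ u ≡ t₁
  λ₁-Z u u∈Z = cong (ℓ D₁) (C₁.φ-identifies-Z u z u∈Z z∈Z)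

  λ₂-Z̄ : ∀ u → Z u ≡ false → λ₂ u ≡ t₂
  λ₂-Z̄ u u∉Z = cong (ℓ D₂) (C₂.φ-identifies-Z u z̄ (cong not u∉Z) (cong not z̄∉Z))

  connected₁ : Connected (T D₁)
  connected₁ = proj₁ (proj₁ (cubic D₁))

  connected₂ : Connected (T D₂)
  connected₂ = proj₁ (proj₁ (cubic D₂))

  t₁-edge : ∃[ p ] adj (T D₁) t₁ (punchIn′ t₁ p) ≡ true
  t₁-edge = neighbour-punchOut′ (T D₁) connected₁ (t₁≢λ₁ z̄ z̄∉Z)

  t₂-edge : ∃[ p ] adj (T D₂) t₂ (punchIn′ t₂ p) ≡ true
  t₂-edge = neighbour-punchOut′ (T D₂) connected₂ (t₂≢λ₂ z z∈Z)

  open TreeJoin {T₁ = T D₁} {T₂ = T D₂} (ℓ-leaf D₁ (C₁.φ z)) (ℓ-leaf D₂ (C₂.φ z̄))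
    (proj₁ t₁-edge) (proj₁ t₂-edge) (proj₂ t₁-edge) (proj₂ t₂-edge)

  -- Vertices outside Z are leaves of T₁ - t₁, vertices in Z leaves of T₂ - t₂.
  positionᵥ : ∀ u b → Z u ≡ b → V
  positionᵥ u true u∈Z = inj₂ (punchOut′ (t₂≢λ₂ u u∈Z))
  positionᵥ u false u∉Z = inj₁ (punchOut′ (t₁≢λ₁ u u∉Z))

  position : Fin (n G) → V
  position u = positionᵥ u (Z u) refl

  leaf : Fin (n G) → Fin (n joined)
  leaf = fromV ∘ position

  Placement : Fin (n G) → V → Set
  Placement u s = (Z u ≡ false × ∃[ i ] s ≡ inj₁ i × ι₁ i ≡ λ₁ u)
                ⊎ (Z u ≡ true × ∃[ j ] s ≡ inj₂ j × ι₂ j ≡ λ₂ u)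

  positionᵥ-placement : ∀ u b (e : Z u ≡ b) → Placement u (positionᵥ u b e)
  positionᵥ-placement u true u∈Z = inj₂ (u∈Z , _ , refl , punchIn′-punchOut′ (t₂≢λ₂ u u∈Z))
  positionᵥ-placement u false u∉Z = inj₁ (u∉Z , _ , refl , punchIn′-punchOut′ (t₁≢λ₁ u u∉Z))

  placement : ∀ u → Placement u (position u)
  placement u = positionᵥ-placement u (Z u) refl

  position-injective : ∀ x y → position x ≡ position y → x ≡ y
  position-injective x y eq with placement x | placement y
  ... | inj₁ (x∉Z , i , px , ιi) | inj₁ (_ , j , py , ιj)
    with λ₁-injective-off-Z (trans (sym ιi) (trans (cong ι₁ (inj₁-injective (trans (sym px) (trans eq py)))) ιj))
  ...   | inj₁ x≡y = x≡y
  ...   | inj₂ (x∈Z , _) = ⊥-elim (true≢false (trans (sym x∈Z) x∉Z))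
  position-injective x y eq | inj₂ (x∈Z , i , px , ιi) | inj₂ (_ , j , py , ιj)
    with λ₂-injective-off-Z̄ (trans (sym ιi) (trans (cong ι₂ (inj₂-injective (trans (sym px) (trans eq py)))) ιj))
  ...   | inj₁ x≡y = x≡y
  ...   | inj₂ (x∉Z , _) = ⊥-elim (true≢false (trans (sym x∈Z) x∉Z))
  position-injective x y eq | inj₁ (_ , _ , px , _) | inj₂ (_ , _ , py , _)
    with trans (sym px) (trans eq py)
  ... | ()
  position-injective x y eq | inj₂ (_ , _ , px , _) | inj₁ (_ , _ , py , _)
    with trans (sym px) (trans eq py)
  ... | ()

  leaf-isLeaf : ∀ x → IsLeaf joined (leaf x)
  leaf-isLeaf x with placement x
  ... | inj₁ (_ , i , px , ιi) = subst (_≤ 1)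
    (sym (trans (cong (degree joined ∘ fromV) px) (trans (degree-inj₁ i) (cong (degree (T D₁)) ιi))))
    (ℓ-leaf D₁ (C₁.φ x))
  ... | inj₂ (_ , j , px , ιj) = subst (_≤ 1)
    (sym (trans (cong (degree joined ∘ fromV) px) (trans (degree-inj₂ j) (cong (degree (T D₂)) ιj))))
    (ℓ-leaf D₂ (C₂.φ x))

  position-from-λ₁ : ∀ u i → λ₁ u ≡ ι₁ i → position u ≡ inj₁ i
  position-from-λ₁ u i e with placement u
  ... | inj₁ (_ , i′ , pu , ιi′) = trans pu (cong inj₁ (punchIn′-injective t₁ (trans ιi′ e)))
  ... | inj₂ (u∈Z , _) = ⊥-elim (punchIn′≢ t₁ i (trans (sym e) (λ₁-Z u u∈Z)))

  position-from-λ₂ : ∀ u j → λ₂ u ≡ ι₂ j → position u ≡ inj₂ j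
  position-from-λ₂ u j e with placement u
  ... | inj₂ (_ , j′ , pu , ιj′) = trans pu (cong inj₂ (punchIn′-injective t₂ (trans ιj′ e)))
  ... | inj₁ (u∉Z , _) = ⊥-elim (punchIn′≢ t₂ j (trans (sym e) (λ₂-Z̄ u u∉Z)))

  position-onto : ∀ s → IsLeaf joined (fromV s) → ∃[ x ] position x ≡ s
  position-onto (inj₁ i) s-leaf with ℓ-onto D₁ (ι₁ i) (subst (_≤ 1) (degree-inj₁ i) s-leaf)
  ... | h , ℓh≡ι₁i with C₁.φ-surjective h
  ...   | u , φu≡h = u , position-from-λ₁ u i (trans (cong (ℓ D₁) φu≡h) ℓh≡ι₁i)
  position-onto (inj₂ j) s-leaf with ℓ-onto D₂ (ι₂ j) (subst (_≤ 1) (degree-inj₂ j) s-leaf)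
  ... | h , ℓh≡ι₂j with C₂.φ-surjective h
  ...   | u , φu≡h = u , position-from-λ₂ u j (trans (cong (ℓ D₂) φu≡h) ℓh≡ι₂j)

  leaf-onto : ∀ w → IsLeaf joined w → ∃[ x ] leaf x ≡ w
  leaf-onto w w-leaf with position-onto (toV w) (subst (IsLeaf joined) (sym (fromV-toV w)) w-leaf)
  ... | x , px = x , trans (cong fromV px) (fromV-toV w)

  decomposition : PMDecomposition G
  decomposition = record
    { T = joined ; cubic = joined-cubicTree (cubic D₁) (cubic D₂) ; ℓ = leaf
    ; ℓ-inj = λ x y e → position-injective x y (fromV-injective e)
    ; ℓ-leaf = leaf-isLeaf ; ℓ-onto = leaf-onto }

  -- Seen from an edge on the T₁ side, every u ∈ Z sits beyond the bridge, where t₁ stands.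
  near₁ : ∀ {a b i} → toV a ≡ inj₁ i → ∀ u → ReachAvoid joined a b (leaf u) (σ₁ (λ₁ u))
  near₁ {a} {b} a≡i u with placement u
  ... | inj₁ (_ , i′ , pu , ιi′) =
    subst (ReachAvoid joined a b (leaf u)) (trans (cong fromV pu) (trans (sym (σ₁-ι₁ i′)) (cong σ₁ ιi′))) here
  ... | inj₂ (u∈Z , j , pu , _) =
    subst₂ (ReachAvoid joined a b) (trans (σ₂-ι₂ j) (sym (cong fromV pu)))
      (trans (sym σ₁-t₁) (cong σ₁ (sym (λ₁-Z u u∈Z))))
      (reach-bridge₂ a≡i (connected₂ (ι₂ j) (ι₂ (proj₁ t₂-edge))) (punchIn′≢ t₂ j))

  near₂ : ∀ {a b j} → toV a ≡ inj₂ j → ∀ u → ReachAvoid joined a b (leaf u) (σ₂ (λ₂ u))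
  near₂ {a} {b} a≡j u with placement u
  ... | inj₂ (_ , j′ , pu , ιj′) =
    subst (ReachAvoid joined a b (leaf u)) (trans (cong fromV pu) (trans (sym (σ₂-ι₂ j′)) (cong σ₂ ιj′))) here
  ... | inj₁ (u∉Z , i , pu , _) =
    subst₂ (ReachAvoid joined a b) (trans (σ₁-ι₁ i) (sym (cong fromV pu)))
      (trans (sym σ₂-t₂) (cong σ₂ (sym (λ₂-Z̄ u u∉Z))))
      (reach-bridge₁ a≡j (connected₁ (ι₁ i) (ι₁ (proj₁ t₁-edge))) (punchIn′≢ t₁ i))

  width₁ : ∀ {k} → WidthAtMost D₁ k → ∀ {a b i} → toV a ≡ inj₁ i → adj joined a b ≡ true →
    ∀ {S} → IsComponent joined a b S → PorosityAtMost G (S ∘ leaf) k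
  width₁ w₁ a≡i e {S} comp =
    porosity-cong (λ u → sym (component-constant comp (near₁ a≡i u)))
      (C₁.porosity-pullback tight (S ∘ σ₁ ∘ ℓ D₁)
        (w₁ _ _ (R₁.π-edge-separated e (proj₁ (proj₂ lifted))) (S ∘ σ₁) (R₁.component-pullback lifted comp)))
    where
    lifted : R₁.LiftedEdge _ _
    lifted = lifted₁ a≡i e

  width₂ : ∀ {k} → WidthAtMost D₂ k → ∀ {a b j} → toV a ≡ inj₂ j → adj joined a b ≡ true →
    ∀ {S} → IsComponent joined a b S → PorosityAtMost G (S ∘ leaf) k
  width₂ w₂ a≡j e {S} comp =
    porosity-cong (λ u → sym (component-constant comp (near₂ a≡j u)))
      (C₂.porosity-pullback (tight-complement {Z = Z} tight) (S ∘ σ₂ ∘ ℓ D₂)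
        (w₂ _ _ (R₂.π-edge-separated e (proj₁ (proj₂ lifted))) (S ∘ σ₂) (R₂.component-pullback lifted comp)))
    where
    lifted : R₂.LiftedEdge _ _
    lifted = lifted₂ a≡j e

  width : ∀ {k} → WidthAtMost D₁ k → WidthAtMost D₂ k → WidthAtMost decomposition k
  width w₁ w₂ a b e S comp = by-side (toV a) refl
    where
    by-side : ∀ s → toV a ≡ s → PorosityAtMost G (S ∘ leaf) _
    by-side (inj₁ i) a≡i = width₁ w₁ a≡i e comp
    by-side (inj₂ j) a≡j = width₂ w₂ a≡j e comp

pmw-tight-cut : ∀ {G H₁ H₂ Z k} → NontrivialTightCut G Z →
  IsContraction G Z H₁ → IsContraction G (complement G Z) H₂ →
  PMWAtMost H₁ k → PMWAtMost H₂ k → PMWAtMost G k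
pmw-tight-cut {G} {Z = Z} (tight , 2≤∣Z∣ , 2≤∣Z̄∣) C₁ C₂ (D₁ , w₁) (D₂ , w₂) =
  decomposition , width w₁ w₂
  where
  z∈Z : ∃[ z ] Z z ≡ true
  z∈Z = count≥1⇒witness Z (≤-trans (s≤s z≤n) 2≤∣Z∣)
  z̄∈Z̄ : ∃[ z̄ ] not (Z z̄) ≡ true
  z̄∈Z̄ = count≥1⇒witness (complement G Z) (≤-trans (s≤s z≤n) 2≤∣Z̄∣)
  open TightCutStep tight (proj₂ z∈Z) (not-injective (proj₂ z̄∈Z̄)) C₁ C₂ D₁ D₂

pmw-from-bricksAndBraces : ∀ {G k} (D : TightCutDecomposition G) →
  All (λ H → PMWAtMost H k) (bricksAndBraces D) → PMWAtMost G k
pmw-from-bricksAndBraces (done _) (pmw ∷ []) = pmw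
pmw-from-bricksAndBraces (split Z cut H₁ H₂ C₁ C₂ D₁ D₂) pmws =
  pmw-tight-cut cut C₁ C₂ (pmw-from-bricksAndBraces D₁ (++⁻ˡ (bricksAndBraces D₁) pmws))
                          (pmw-from-bricksAndBraces D₂ (++⁻ʳ (bricksAndBraces D₁) pmws))

proposition1 : (G : Graph) → MatchingCovered G →
    (D : TightCutDecomposition G) → (k : ℕ) →
    All (λ H → PMWAtMost H k) (bricksAndBraces D) →
    PMWAtMost G k
proposition1 G _ D k = pmw-from-bricksAndBraces D
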